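{- Let $\mathcal{G}$ be the set of partitions $\lambda=(\lambda_1>\lambda_2>\cdots>\lambda_\ell)$ into distinct positive parts (empty partition included) such that $\lambda_{2i}-\lambda_{2i+1}$ is even whenever $2i+1\le\ell$, and, if $\ell$ is even, the smallest part $\lambda_\ell$ is even. For a partition let $|\lambda_o|=\lambda_1+\lambda_3+\lambda_5+\cdots$ (sum of odd-indexed parts) and $|\lambda_e|=\lambda_2+\lambda_4+\cdots$ (sum of even-indexed parts). Then $$\sum_{\lambda\in\mathcal{G}}x^{|\lambda_{o}|}y^{|\lambda_{e}|}=\sum_{n=0}^{\infty}\frac{x^{\frac{3n^2-n}{2}}y^{\frac{3n^2-3n}{2}}}{(x;xy)_n(x^2y^2;x^2y^2)_{n}}.$$
   Context: $(a;t)_n=\prod_{i=0}^{n-1}(1-at^i)$; identity of formal power series in $x,y$. -}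

module Defs where

open import Data.Nat using (ℕ; zero; suc; _+_; _*_; _∸_; _<_; _≤_; _≡ᵇ_; _/_)
open import Data.Nat.Divisibility using (_∣_)
open import Data.Bool using (if_then_else_; _∧_)
open import Data.List using (List; []; _∷_)
open import Data.Unit using (⊤)
open import Data.Product using (_×_)

StrictDecPos : List ℕ → Set
StrictDecPos []            = ⊤
StrictDecPos (a ∷ [])      = 1 ≤ a
StrictDecPos (a ∷ b ∷ r)   = b < a × StrictDecPos (b ∷ r)

-- The extra conditions defining 𝒢, read starting from an odd index
-- position (λ₁ has index 1):
--   * λ_{2i} − λ_{2i+1} even whenever 2i+1 ≤ ℓ,
--   * if ℓ is even (and ℓ ≥ 2), λ_ℓ is even.
GCond : List ℕ → Set
GCond []                = ⊤
GCond (a ∷ [])          = ⊤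
GCond (a ∷ b ∷ [])      = 2 ∣ b
GCond (a ∷ b ∷ c ∷ r)   = 2 ∣ (b ∸ c) × GCond (c ∷ r)

InG : List ℕ → Set
InG p = StrictDecPos p × GCond p

sumO sumE : List ℕ → ℕ
sumO []      = 0
sumO (a ∷ r) = a + sumE r
sumE []      = 0
sumE (a ∷ r) = sumO r

-- Formal power series in x, y with ℕ coefficients: f a b = [x^a y^b] f.

FPS : Set
FPS = ℕ → ℕ → ℕ

sumTo : ℕ → (ℕ → ℕ) → ℕ
sumTo zero    f = f 0
sumTo (suc n) f = sumTo n f + f (suc n)

infixl 7 _⊛_
_⊛_ : FPS → FPS → FPS
(f ⊛ g) a b = sumTo a λ i → sumTo b λ j → f i j * g (a ∸ i) (b ∸ j)

one : FPS
one a b = if (a ≡ᵇ 0) ∧ (b ≡ᵇ 0) then 1 else 0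

mon : ℕ → ℕ → FPS
mon p q a b = if (a ≡ᵇ p) ∧ (b ≡ᵇ q) then 1 else 0

-- 1/(1 − x^p y^q) = Σ_{k≥0} x^{kp} y^{kq}, for p ≥ 1.
-- Since p ≥ 1, only k ≤ a contributes to the coefficient of x^a y^b.
geom : (p q : ℕ) → .(1 ≤ p) → FPS
geom p q _ a b = sumTo a λ k → mon (k * p) (k * q) a b

prodTo : ℕ → (ℕ → FPS) → FPS
prodTo zero    f = one
prodTo (suc n) f = prodTo n f ⊛ f n

open import Data.Nat using (s≤s; z≤n)

-- 1/(x;xy)_n = Π_{i=0}^{n-1} 1/(1 − x·(xy)^i)
invPochA : ℕ → FPS
invPochA n = prodTo n λ i → geom (suc i) i (s≤s z≤n)

-- 1/(x²y²;x²y²)_n = Π_{i=0}^{n-1} 1/(1 − (x²y²)^{i+1})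
invPochB : ℕ → FPS
invPochB n = prodTo n λ i → geom (2 * suc i) (2 * suc i) (s≤s z≤n)

term : ℕ → FPS
term n = mon ((3 * n * n ∸ n) / 2) ((3 * n * n ∸ 3 * n) / 2) ⊛ invPochA n ⊛ invPochB n

-- Coefficient of x^a y^b in Σ_{n≥0} term n.  The x-degree of term n is
-- ≥ (3n²−n)/2 ≥ n, so only n ≤ a contribute.
rhsCoeff : FPS
rhsCoeff a b = sumTo a λ n → term n a b

-- Cut a partition in 𝒢 from the top into blocks (λ₁, λ₂), (λ₃, λ₄), …, the last one possibly a
-- single part. Block k is described by a pair (α_k, β_k) of naturals: its upper part exceeds its
-- lower part by α_k + 1, and its lower part exceeds the upper part of the next block by the even
-- gap 2(β_k + 1) (for the last block: the lower part is 2β_k, absent when 0). This identifies 𝒢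
-- with finite sequences of such pairs. Since α_k enters k odd-indexed and k − 1 even-indexed
-- parts, and 2β_k enters k parts of each kind, a sequence of length n has weight
--   x^{(3n² − n)/2 + Σ k α_k + Σ 2k β_k} y^{(3n² − 3n)/2 + Σ (k − 1) α_k + Σ 2k β_k},
-- and summing over the α_k and β_k gives the n-th term of the right-hand side.

module Submission where

open import Defs
open import Data.Bool using (Bool; true; false; T; _∧_; if_then_else_)
open import Data.Bool.Properties using (T-∧)
open import Data.Nat
open import Data.Nat.Properties
open import Data.Nat.DivMod using (m*n/n≡m; m*[n/m]≡n)
open import Data.Nat.Divisibility using (_∣_; m∣m*n)
open import Data.Nat.ListAction using (sum)
open import Data.List using (List; []; _∷_; length; map; foldr; zip; unzip; _++_; _∷ʳ_; cartesianProduct; initLast; _∷ʳ′_)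
open import Data.List.Properties
  using (length-++; length-map; ∷ʳ-injective; length-zipWith; length-unzipWith₁; length-unzipWith₂; zip-unzip; unzip-zip)
open import Data.List.Membership.Propositional using (_∈_)
open import Data.List.Membership.Propositional.Properties
  using (∈-++⁺ˡ; ∈-++⁺ʳ; ∈-++⁻; ∈-map⁺; ∈-map⁻; ∈-cartesianProduct⁺; ∈-cartesianProduct⁻)
open import Data.List.Relation.Unary.Any using (here; there)
import Data.List.Relation.Unary.All as All
import Data.List.Relation.Unary.All.Properties as All
open import Data.List.Relation.Unary.AllPairs using ([]; _∷_)
open import Data.List.Relation.Unary.Unique.Propositional using (Unique)
import Data.List.Relation.Unary.Unique.Propositional.Properties as Unique
open import Data.Product using (Σ; ∃-syntax; _×_; _,_; proj₁; proj₂; uncurry)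
open import Data.Sum using (inj₁; inj₂)
open import Data.Unit using (⊤; tt)
open import Function using (_∘_; id)
open import Relation.Nullary using (contradiction)
open import Function.Bundles using (_⇔_; mk⇔; Equivalence)
open import Relation.Binary.PropositionalEquality
open import Data.Nat.Tactic.RingSolver using (solve-∀)

private variable
  A B : Set

concatTo : ℕ → (ℕ → List A) → List A
concatTo zero    f = f 0
concatTo (suc n) f = concatTo n f ++ f (suc n)

sumTo-cong : ∀ n {f g : ℕ → ℕ} → (∀ k → f k ≡ g k) → sumTo n f ≡ sumTo n g
sumTo-cong zero    f≗g = f≗g 0
sumTo-cong (suc n) f≗g = cong₂ _+_ (sumTo-cong n f≗g) (f≗g (suc n))

length-concatTo : ∀ n (f : ℕ → List A) → length (concatTo n f) ≡ sumTo n (length ∘ f)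
length-concatTo zero    f = refl
length-concatTo (suc n) f =
  trans (length-++ (concatTo n f)) (cong (_+ length (f (suc n))) (length-concatTo n f))

∈-concatTo⁻ : ∀ n (f : ℕ → List A) {x} → x ∈ concatTo n f → ∃[ k ] k ≤ n × x ∈ f k
∈-concatTo⁻ zero    f x∈ = 0 , z≤n , x∈
∈-concatTo⁻ (suc n) f x∈ with ∈-++⁻ (concatTo n f) x∈
... | inj₁ x∈′ = let k , k≤n , x∈fk = ∈-concatTo⁻ n f x∈′ in k , m≤n⇒m≤1+n k≤n , x∈fk
... | inj₂ x∈′ = suc n , ≤-refl , x∈′

∈-concatTo⁺ : ∀ {n} (f : ℕ → List A) {k x} → k ≤ n → x ∈ f k → x ∈ concatTo n f
∈-concatTo⁺ {n = zero}  f z≤n x∈ = x∈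
∈-concatTo⁺ {n = suc n} f k≤ x∈ with m≤n⇒m<n∨m≡n k≤
... | inj₁ k<1+n = ∈-++⁺ˡ (∈-concatTo⁺ f (s≤s⁻¹ k<1+n) x∈)
... | inj₂ refl  = ∈-++⁺ʳ (concatTo n f) x∈

concatTo-unique : ∀ n (f : ℕ → List A) → (∀ k → Unique (f k)) →
                  (∀ {x k l} → x ∈ f k → x ∈ f l → k ≡ l) → Unique (concatTo n f)
concatTo-unique zero    f unique disjoint = unique 0
concatTo-unique (suc n) f unique disjoint =
  Unique.++⁺ (concatTo-unique n f unique disjoint) (unique (suc n)) λ (x∈ , x∈′) →
    let k , k≤n , x∈fk = ∈-concatTo⁻ n f x∈ in <⇒≢ (s≤s k≤n) (disjoint x∈fk x∈′)

map-unique : (φ : A → B) {xs : List A} → (∀ {x y} → x ∈ xs → y ∈ xs → φ x ≡ φ y → x ≡ y) →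
             Unique xs → Unique (map φ xs)
map-unique φ {[]}     inj []          = []
map-unique φ {x ∷ xs} inj (x∉ ∷ uniq) =
  All.map⁺ (All.tabulate λ y∈ φx≡φy → All.lookup x∉ y∈ (inj (here refl) (there y∈) φx≡φy))
  ∷ map-unique φ (λ x∈ y∈ → inj (there x∈) (there y∈)) uniq

length-cartesianProduct : (xs : List A) (ys : List B) →
                          length (cartesianProduct xs ys) ≡ length xs * length ys
length-cartesianProduct []       ys = refl
length-cartesianProduct (x ∷ xs) ys =
  trans (length-++ (map (x ,_) ys)) (cong₂ _+_ (length-map (x ,_) ys) (length-cartesianProduct xs ys))

record Enumeration (P : A → Set) (wx wy : A → ℕ) (F : FPS) : Set where
  field
    enum        : ℕ → ℕ → List A
    unique      : ∀ a b → Unique (enum a b)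
    sound       : ∀ {a b x} → x ∈ enum a b → P x × wx x ≡ a × wy x ≡ b
    complete    : ∀ {x} → P x → x ∈ enum (wx x) (wy x)
    length-enum : ∀ a b → length (enum a b) ≡ F a b

open Enumeration

module _ {P : A → Set} {Q : B → Set} {wx wy : A → ℕ} {vx vy : B → ℕ} {F : FPS} where

  map-enumeration : (φ : A → B) →
    (∀ {x y} → P x → P y → φ x ≡ φ y → x ≡ y) →
    (∀ {x} → P x → Q (φ x) × vx (φ x) ≡ wx x × vy (φ x) ≡ wy x) →
    (∀ {y} → Q y → ∃[ x ] P x × φ x ≡ y) →
    Enumeration P wx wy F → Enumeration Q vx vy F
  map-enumeration φ inj preserves onto E = record
    { enum        = λ a b → map φ (enum E a b)
    ; unique      = λ a b → map-unique φ (λ x∈ y∈ → inj (proj₁ (sound E x∈)) (proj₁ (sound E y∈))) (unique E a b)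
    ; sound       = sound′
    ; complete    = complete′
    ; length-enum = λ a b → trans (length-map φ (enum E a b)) (length-enum E a b)
    }
    where
    sound′ : ∀ {a b y} → y ∈ map φ (enum E a b) → Q y × vx y ≡ a × vy y ≡ b
    sound′ y∈ with ∈-map⁻ φ y∈
    ... | x , x∈ , refl with sound E x∈
    ...   | Px , refl , refl = preserves Px
    complete′ : ∀ {y} → Q y → y ∈ map φ (enum E (vx y) (vy y))
    complete′ Qy with onto Qy
    ... | x , Px , refl with preserves Px
    ...   | _ , vx≡ , vy≡ rewrite vx≡ | vy≡ = ∈-map⁺ φ (complete E Px)

module _ {P Q : A → Set} {wx wy : A → ℕ} {F : FPS} where

  equivalent : (∀ {x} → P x ⇔ Q x) → Enumeration P wx wy F → Enumeration Q wx wy F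
  equivalent P⇔Q = map-enumeration id (λ _ _ → id)
    (λ Px → Equivalence.to P⇔Q Px , refl , refl) (λ Qy → _ , Equivalence.from P⇔Q Qy , refl)

singletonIf : Bool → A → List A
singletonIf true  x = x ∷ []
singletonIf false x = []

length-singletonIf : ∀ c (x : A) → length (singletonIf c x) ≡ (if c then 1 else 0)
length-singletonIf true  x = refl
length-singletonIf false x = refl

singletonIf-unique : ∀ c (x : A) → Unique (singletonIf c x)
singletonIf-unique true  x = All.[] ∷ []
singletonIf-unique false x = []

∈-singletonIf⁺ : ∀ {c} {x : A} → T c → x ∈ singletonIf c x
∈-singletonIf⁺ {c = true} _ = here refl

∈-singletonIf⁻ : ∀ {c} {x y : A} → y ∈ singletonIf c x → T c × y ≡ x
∈-singletonIf⁻ {c = true} (here refl) = _ , refl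

module _ {wx wy : A → ℕ} where

  monomial : (x : A) → Enumeration (_≡ x) wx wy (mon (wx x) (wy x))
  monomial x = record
    { enum        = λ a b → singletonIf (matches a b) x
    ; unique      = λ a b → singletonIf-unique (matches a b) x
    ; sound       = sound′
    ; complete    = λ { refl → ∈-singletonIf⁺ (Equivalence.from T-∧ (≡⇒≡ᵇ (wx x) _ refl , ≡⇒≡ᵇ (wy x) _ refl)) }
    ; length-enum = λ a b → length-singletonIf (matches a b) x
    }
    where
    matches : ℕ → ℕ → Bool
    matches a b = (a ≡ᵇ wx x) ∧ (b ≡ᵇ wy x)
    sound′ : ∀ {a b y} → y ∈ singletonIf (matches a b) x → y ≡ x × wx y ≡ a × wy y ≡ b
    sound′ {a} {b} y∈ with ∈-singletonIf⁻ y∈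
    ... | matched , refl with Equivalence.to T-∧ matched
    ...   | a≡ , b≡ = refl , sym (≡ᵇ⇒≡ a (wx x) a≡) , sym (≡ᵇ⇒≡ b (wy x) b≡)

module _ {P : ℕ → A → Set} {wx wy : A → ℕ} {F : ℕ → FPS} where

  sum-enumeration : (∀ n → Enumeration (P n) wx wy (F n)) →
    (∀ {m n x} → P m x → P n x → m ≡ n) →
    (∀ {n x} → P n x → n ≤ wx x) →
    Enumeration (λ x → ∃[ n ] P n x) wx wy (λ a b → sumTo a λ n → F n a b)
  sum-enumeration E disjoint degree = record
    { enum        = λ a b → concatTo a λ n → enum (E n) a b
    ; unique      = λ a b → concatTo-unique a _ (λ n → unique (E n) a b)
                      λ x∈ x∈′ → disjoint (proj₁ (sound (E _) x∈)) (proj₁ (sound (E _) x∈′))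
    ; sound       = λ {a} {b} x∈ → let n , _ , x∈′ = ∈-concatTo⁻ a _ x∈ ; Px , wx≡ , wy≡ = sound (E n) x∈′
                                   in (n , Px) , wx≡ , wy≡
    ; complete    = λ (n , Px) → ∈-concatTo⁺ _ (degree Px) (complete (E n) Px)
    ; length-enum = λ a b → trans (length-concatTo a _) (sumTo-cong a λ n → length-enum (E n) a b)
    }

module _ {P₁ : A → Set} {P₂ : B → Set} {w₁ v₁ : A → ℕ} {w₂ v₂ : B → ℕ} {F G : FPS} where

  infixl 7 _⊗_
  _⊗_ : Enumeration P₁ w₁ v₁ F → Enumeration P₂ w₂ v₂ G →
        Enumeration (λ (x , y) → P₁ x × P₂ y) (λ (x , y) → w₁ x + w₂ y) (λ (x , y) → v₁ x + v₂ y) (F ⊛ G)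
  E₁ ⊗ E₂ = record
    { enum        = pairs
    ; unique      = λ a b → concatTo-unique a _
                      (λ i → concatTo-unique b _ (λ j → Unique.cartesianProduct⁺ (unique E₁ i j) (unique E₂ _ _))
                        λ xy∈ xy∈′ → trans (sym (proj₂ (weight₁ xy∈))) (proj₂ (weight₁ xy∈′)))
                      λ xy∈ xy∈′ → trans (sym (weightˣ₁ b xy∈)) (weightˣ₁ b xy∈′)
    ; sound       = sound′
    ; complete    = complete′
    ; length-enum = λ a b → trans (length-concatTo a _) (sumTo-cong a λ i → trans (length-concatTo b _)
                      (sumTo-cong b λ j → trans (length-cartesianProduct (enum E₁ i j) _)
                        (cong₂ _*_ (length-enum E₁ i j) (length-enum E₂ _ _))))
    }
    where
    block : ℕ → ℕ → ℕ → ℕ → List (A × B)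
    block a b i j = cartesianProduct (enum E₁ i j) (enum E₂ (a ∸ i) (b ∸ j))
    pairs : ℕ → ℕ → List (A × B)
    pairs a b = concatTo a λ i → concatTo b λ j → block a b i j
    weight₁ : ∀ {a b i j x y} → (x , y) ∈ block a b i j → w₁ x ≡ i × v₁ x ≡ j
    weight₁ {i = i} {j} xy∈ = proj₂ (sound E₁ (proj₁ (∈-cartesianProduct⁻ (enum E₁ i j) _ xy∈)))
    weightˣ₁ : ∀ {a i x y} b → (x , y) ∈ concatTo b (block a b i) → w₁ x ≡ i
    weightˣ₁ b xy∈ = let _ , _ , xy∈′ = ∈-concatTo⁻ b _ xy∈ in proj₁ (weight₁ xy∈′)
    sound′ : ∀ {a b} {(x , y) : A × B} → (x , y) ∈ pairs a b → (P₁ x × P₂ y) × w₁ x + w₂ y ≡ a × v₁ x + v₂ y ≡ b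
    sound′ {a} {b} xy∈ with ∈-concatTo⁻ a _ xy∈
    ... | i , i≤a , xy∈′ with ∈-concatTo⁻ b _ xy∈′
    ...   | j , j≤b , xy∈″ with ∈-cartesianProduct⁻ (enum E₁ i j) _ xy∈″
    ...     | x∈ , y∈ with sound E₁ x∈ | sound E₂ y∈
    ...       | P₁x , wx≡ , wy≡ | P₂y , vx≡ , vy≡ =
      (P₁x , P₂y) , trans (cong₂ _+_ wx≡ vx≡) (m+[n∸m]≡n i≤a) , trans (cong₂ _+_ wy≡ vy≡) (m+[n∸m]≡n j≤b)
    complete′ : ∀ {(x , y) : A × B} → P₁ x × P₂ y → (x , y) ∈ pairs (w₁ x + w₂ y) (v₁ x + v₂ y)
    complete′ {x , y} (P₁x , P₂y) =
      ∈-concatTo⁺ _ (m≤m+n (w₁ x) (w₂ y)) (∈-concatTo⁺ _ (m≤m+n (v₁ x) (v₂ y))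
        (∈-cartesianProduct⁺ (complete E₁ P₁x)
          (subst₂ (λ a b → y ∈ enum E₂ a b) (sym (m+n∸m≡n (w₁ x) _)) (sym (m+n∸m≡n (v₁ x) _)) (complete E₂ P₂y))))

geometric : ∀ p q (h : 1 ≤ p) → Enumeration (λ (_ : ℕ) → ⊤) (_* p) (_* q) (geom p q h)
geometric p q h = equivalent (λ {k} → mk⇔ _ λ _ → k , refl)
  (sum-enumeration monomial (λ { refl refl → refl }) λ { {n} refl → m≤m*n n p ⦃ >-nonZero h ⦄ })

weightedSum : (ℕ → ℕ) → List ℕ → ℕ
weightedSum c []       = 0
weightedSum c (k ∷ ks) = k * c 0 + weightedSum (c ∘ suc) ks

weightedSum-∷ʳ : ∀ c ks k → weightedSum c (ks ∷ʳ k) ≡ weightedSum c ks + k * c (length ks)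
weightedSum-∷ʳ c []       k = +-identityʳ (k * c 0)
weightedSum-∷ʳ c (k′ ∷ ks) k =
  trans (cong (k′ * c 0 +_) (weightedSum-∷ʳ (c ∘ suc) ks k)) (sym (+-assoc (k′ * c 0) _ _))

weightedSum-shift : ∀ {c} d → (∀ i → c (suc i) ≡ c i + d) →
                    ∀ ks → weightedSum (c ∘ suc) ks ≡ weightedSum c ks + d * sum ks
weightedSum-shift d c[1+i] []       = sym (*-zeroʳ d)
weightedSum-shift {c} d c[1+i] (k ∷ ks) = begin
    k * c 1 + weightedSum (c ∘ suc ∘ suc) ks
  ≡⟨ cong₂ (λ c₁ w → k * c₁ + w) (c[1+i] 0) (weightedSum-shift d (c[1+i] ∘ suc) ks) ⟩
    k * (c 0 + d) + (weightedSum (c ∘ suc) ks + d * sum ks)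
  ≡⟨ rearrange k (c 0) d (weightedSum (c ∘ suc) ks) (sum ks) ⟩
    k * c 0 + weightedSum (c ∘ suc) ks + d * (k + sum ks)
  ∎
  where
  open ≡-Reasoning
  rearrange : ∀ k c₀ d w s → k * (c₀ + d) + (w + d * s) ≡ k * c₀ + w + d * (k + s)
  rearrange = solve-∀

length-∷ʳ : (xs : List A) (x : A) → length (xs ∷ʳ x) ≡ suc (length xs)
length-∷ʳ xs x = trans (length-++ xs) (+-comm (length xs) 1)

geometricProduct : (p q : ℕ → ℕ) (h : ∀ i → 1 ≤ p i) (n : ℕ) →
  Enumeration (λ ks → length ks ≡ n) (weightedSum p) (weightedSum q) (prodTo n λ i → geom (p i) (q i) (h i))
geometricProduct p q h zero    = equivalent (mk⇔ (cong length) length≡0) (monomial [])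
  where
  length≡0 : ∀ {ks : List ℕ} → length ks ≡ 0 → ks ≡ []
  length≡0 {[]} _ = refl
geometricProduct p q h (suc n) =
  map-enumeration (uncurry _∷ʳ_) (λ _ _ → injective) (λ {(ks , k)} → preserves ks k) onto
    (geometricProduct p q h n ⊗ geometric (p n) (q n) (h n))
  where
  injective : ∀ {(ks , k) (ks′ , k′) : List ℕ × ℕ} → ks ∷ʳ k ≡ ks′ ∷ʳ k′ → (ks , k) ≡ (ks′ , k′)
  injective {ks , _} {ks′ , _} eq = let ks≡ , k≡ = ∷ʳ-injective ks ks′ eq in cong₂ _,_ ks≡ k≡
  preserves : ∀ ks k → length ks ≡ n × ⊤ →
    length (ks ∷ʳ k) ≡ suc n × weightedSum p (ks ∷ʳ k) ≡ weightedSum p ks + k * p n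
                             × weightedSum q (ks ∷ʳ k) ≡ weightedSum q ks + k * q n
  preserves ks k (refl , _) = length-∷ʳ ks k , weightedSum-∷ʳ p ks k , weightedSum-∷ʳ q ks k
  onto : ∀ {ks} → length ks ≡ suc n → ∃[ (ks′ , k) ] (length ks′ ≡ n × ⊤) × ks′ ∷ʳ k ≡ ks
  onto {ks} len with initLast ks
  ... | ks′ ∷ʳ′ k = (ks′ , k) , (suc-injective (trans (sym (length-∷ʳ ks′ k)) len) , _) , refl

offset : List ℕ → ℕ
offset []      = 0
offset (μ ∷ _) = 2 + μ

_∷⁺_ : ℕ → List ℕ → List ℕ
zero  ∷⁺ p = p
suc ν ∷⁺ p = suc ν ∷ p

placeBlock : ℕ × ℕ → List ℕ → List ℕ
placeBlock (α , β) p = ν + suc α ∷ ν ∷⁺ p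
  where ν = offset p + 2 * β

fromBlocks : List (ℕ × ℕ) → List ℕ
fromBlocks = foldr placeBlock []

toBlocks : List ℕ → List (ℕ × ℕ)
toBlocks []               = []
toBlocks (μ ∷ [])         = (pred μ , 0) ∷ []
toBlocks (μ ∷ ν ∷ [])     = (pred (μ ∸ ν) , ν / 2) ∷ []
toBlocks (μ ∷ ν ∷ μ′ ∷ r) = (pred (μ ∸ ν) , pred ((ν ∸ μ′) / 2)) ∷ toBlocks (μ′ ∷ r)

2*n/2≡n : ∀ n → 2 * n / 2 ≡ n
2*n/2≡n n = trans (cong (_/ 2) (*-comm 2 n)) (m*n/n≡m n 2)

2+m+2n≡2[1+n]+m : ∀ m n → 2 + m + 2 * n ≡ 2 * suc n + m
2+m+2n≡2[1+n]+m = solve-∀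

2+m+2n∸m≡2[1+n] : ∀ m n → 2 + m + 2 * n ∸ m ≡ 2 * suc n
2+m+2n∸m≡2[1+n] m n = trans (cong (_∸ m) (2+m+2n≡2[1+n]+m m n)) (m+n∸n≡m (2 * suc n) m)

toBlocks-placeBlock : ∀ x p → toBlocks (placeBlock x p) ≡ x ∷ toBlocks p
toBlocks-placeBlock (α , β)     (μ ∷ r) =
  cong₂ (λ α′ β′ → (α′ , β′) ∷ toBlocks (μ ∷ r)) (cong pred (m+n∸m≡n (2 + μ + 2 * β) (suc α)))
    (cong pred (trans (cong (_/ 2) (2+m+2n∸m≡2[1+n] μ β)) (2*n/2≡n (suc β))))
toBlocks-placeBlock (α , zero)  []      = refl
toBlocks-placeBlock (α , suc β) []      =
  cong₂ (λ α′ β′ → (α′ , β′) ∷ []) (cong pred (m+n∸m≡n (2 * suc β) (suc α))) (2*n/2≡n (suc β))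

toBlocks-fromBlocks : ∀ l → toBlocks (fromBlocks l) ≡ l
toBlocks-fromBlocks []      = refl
toBlocks-fromBlocks (x ∷ l) = trans (toBlocks-placeBlock x (fromBlocks l)) (cong (x ∷_) (toBlocks-fromBlocks l))

fromBlocks-injective : ∀ {l l′} → fromBlocks l ≡ fromBlocks l′ → l ≡ l′
fromBlocks-injective {l} {l′} eq =
  trans (sym (toBlocks-fromBlocks l)) (trans (cong toBlocks eq) (toBlocks-fromBlocks l′))

placeBlock-InG : ∀ x p → InG p → InG (placeBlock x p)
placeBlock-InG (α , β)     (μ ∷ r) (decreasing , gaps) =
  (m<m+n _ 0<1+n , <-≤-trans (m<n+m μ {2} 0<1+n) (m≤m+n (2 + μ) (2 * β)) , decreasing) ,
  subst (2 ∣_) (sym (2+m+2n∸m≡2[1+n] μ β)) (m∣m*n (suc β)) , gaps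
placeBlock-InG (α , zero)  []      _ = 0<1+n , _
placeBlock-InG (α , suc β) []      _ = (m<m+n _ 0<1+n , 0<1+n) , m∣m*n (suc β)

fromBlocks-InG : ∀ l → InG (fromBlocks l)
fromBlocks-InG []      = _ , _
fromBlocks-InG (x ∷ l) = placeBlock-InG x (fromBlocks l) (fromBlocks-InG l)

m+suc[pred[n∸m]]≡n : ∀ {ν μ} → ν < μ → ν + suc (pred (μ ∸ ν)) ≡ μ
m+suc[pred[n∸m]]≡n {ν} ν<μ = trans (cong (ν +_) (suc-pred _ ⦃ >-nonZero (m<n⇒0<n∸m ν<μ) ⦄)) (m+[n∸m]≡n (<⇒≤ ν<μ))

2+m+2*pred[[n∸m]/2]≡n : ∀ {μ′ ν} → μ′ < ν → 2 ∣ ν ∸ μ′ → 2 + μ′ + 2 * pred ((ν ∸ μ′) / 2) ≡ ν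
2+m+2*pred[[n∸m]/2]≡n {μ′} {ν} μ′<ν 2∣gap = begin
    2 + μ′ + 2 * pred k
  ≡⟨ 2+m+2n≡2[1+n]+m μ′ (pred k) ⟩
    2 * suc (pred k) + μ′
  ≡⟨ cong (λ k′ → 2 * k′ + μ′) (suc-pred k ⦃ ≢-nonZero k≢0 ⦄) ⟩
    2 * k + μ′
  ≡⟨ cong (_+ μ′) (m*[n/m]≡n 2∣gap) ⟩
    ν ∸ μ′ + μ′
  ≡⟨ m∸n+n≡m (<⇒≤ μ′<ν) ⟩
    ν ∎
  where
  open ≡-Reasoning
  k = (ν ∸ μ′) / 2
  k≢0 : k ≢ 0
  k≢0 k≡0 = <⇒≢ (m<n⇒0<n∸m μ′<ν) (trans (sym (cong (2 *_) k≡0)) (m*[n/m]≡n 2∣gap))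

fromBlocks-toBlocks : ∀ p → InG p → fromBlocks (toBlocks p) ≡ p
fromBlocks-toBlocks []                      _ = refl
fromBlocks-toBlocks (suc μ ∷ [])            _ = refl
fromBlocks-toBlocks (μ ∷ ν ∷ [])            ((ν<μ , 0<ν) , 2∣ν) = two-parts (ν / 2) (m*[n/m]≡n 2∣ν)
  where
  two-parts : ∀ k → 2 * k ≡ ν → placeBlock (pred (μ ∸ ν) , k) [] ≡ μ ∷ ν ∷ []
  two-parts zero    0≡ν  = contradiction 0≡ν (<⇒≢ 0<ν)
  two-parts (suc β) 2k≡ν =
    cong₂ (λ μ₀ ν₀ → μ₀ ∷ ν₀ ∷ []) (trans (cong (_+ suc (pred (μ ∸ ν))) 2k≡ν) (m+suc[pred[n∸m]]≡n ν<μ)) 2k≡ν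
fromBlocks-toBlocks (μ ∷ ν ∷ μ′ ∷ r) ((ν<μ , μ′<ν , decreasing) , 2∣gap , gaps) = begin
    placeBlock (pred (μ ∸ ν) , β) (fromBlocks (toBlocks (μ′ ∷ r)))
  ≡⟨ cong (placeBlock (pred (μ ∸ ν) , β)) (fromBlocks-toBlocks (μ′ ∷ r) (decreasing , gaps)) ⟩
    2 + μ′ + 2 * β + suc (pred (μ ∸ ν)) ∷ 2 + μ′ + 2 * β ∷ μ′ ∷ r
  ≡⟨ cong (λ ν₀ → ν₀ + suc (pred (μ ∸ ν)) ∷ ν₀ ∷ μ′ ∷ r) (2+m+2*pred[[n∸m]/2]≡n μ′<ν 2∣gap) ⟩
    ν + suc (pred (μ ∸ ν)) ∷ ν ∷ μ′ ∷ r
  ≡⟨ cong (λ μ₀ → μ₀ ∷ ν ∷ μ′ ∷ r) (m+suc[pred[n∸m]]≡n ν<μ) ⟩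
    μ ∷ ν ∷ μ′ ∷ r ∎
  where
  open ≡-Reasoning
  β = pred ((ν ∸ μ′) / 2)

sumO-placeBlock : ∀ α β p → sumO (placeBlock (α , β) p) ≡ offset p + 2 * β + suc α + sumO p
sumO-placeBlock α β       (μ ∷ r) = refl
sumO-placeBlock α zero    []      = refl
sumO-placeBlock α (suc β) []      = refl

sumE-placeBlock : ∀ α β p → sumE (placeBlock (α , β) p) ≡ offset p + 2 * β + sumE p
sumE-placeBlock α β       (μ ∷ r) = refl
sumE-placeBlock α zero    []      = refl
sumE-placeBlock α (suc β) []      = refl

choose₂ : ℕ → ℕ
choose₂ zero    = 0
choose₂ (suc n) = choose₂ n + n

oddWeight evenWeight : List (ℕ × ℕ) → ℕ
oddWeight  l = 3 * choose₂ (length l) + length l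
             + weightedSum suc (proj₁ (unzip l)) + weightedSum (λ i → 2 * suc i) (proj₂ (unzip l))
evenWeight l = 3 * choose₂ (length l)
             + weightedSum id (proj₁ (unzip l)) + weightedSum (λ i → 2 * suc i) (proj₂ (unzip l))

offset-fromBlocks : ∀ l → offset (fromBlocks l) ≡ 3 * length l + sum (proj₁ (unzip l)) + 2 * sum (proj₂ (unzip l))
offset-fromBlocks []              = refl
offset-fromBlocks ((α , β) ∷ l) = begin
    2 + (offset (fromBlocks l) + 2 * β + suc α)
  ≡⟨ cong (λ o → 2 + (o + 2 * β + suc α)) (offset-fromBlocks l) ⟩
    2 + (3 * L + Sα + 2 * Sβ + 2 * β + suc α)
  ≡⟨ arith α β L Sα Sβ ⟩
    3 * suc L + (α + Sα) + 2 * (β + Sβ) ∎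
  where
  open ≡-Reasoning
  L  = length l
  Sα = sum (proj₁ (unzip l))
  Sβ = sum (proj₂ (unzip l))
  arith : ∀ α β L Sα Sβ → 2 + (3 * L + Sα + 2 * Sβ + 2 * β + suc α) ≡ 3 * suc L + (α + Sα) + 2 * (β + Sβ)
  arith = solve-∀

sumO-fromBlocks : ∀ l → sumO (fromBlocks l) ≡ oddWeight l
sumO-fromBlocks []              = refl
sumO-fromBlocks ((α , β) ∷ l) = begin
    sumO (placeBlock (α , β) (fromBlocks l))
  ≡⟨ sumO-placeBlock α β (fromBlocks l) ⟩
    offset (fromBlocks l) + 2 * β + suc α + sumO (fromBlocks l)
  ≡⟨ cong₂ (λ o w → o + 2 * β + suc α + w) (offset-fromBlocks l) (sumO-fromBlocks l) ⟩
    3 * L + Sα + 2 * Sβ + 2 * β + suc α + (3 * C + L + Wα + Wβ)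
  ≡⟨ arith α β L Sα Sβ C Wα Wβ ⟩
    3 * (C + L) + suc L + (α * 1 + (Wα + 1 * Sα)) + (β * 2 + (Wβ + 2 * Sβ))
  ≡⟨ cong₂ (λ wα wβ → 3 * (C + L) + suc L + (α * 1 + wα) + (β * 2 + wβ))
       (sym (weightedSum-shift 1 (λ i → +-comm 1 (suc i)) as))
       (sym (weightedSum-shift 2 (λ i → trans (*-suc 2 (suc i)) (+-comm 2 _)) bs)) ⟩
    oddWeight ((α , β) ∷ l) ∎
  where
  open ≡-Reasoning
  L  = length l
  as = proj₁ (unzip l)
  bs = proj₂ (unzip l)
  Sα = sum as
  Sβ = sum bs
  C  = choose₂ L
  Wα = weightedSum suc as
  Wβ = weightedSum (λ i → 2 * suc i) bs
  arith : ∀ α β L Sα Sβ C Wα Wβ → 3 * L + Sα + 2 * Sβ + 2 * β + suc α + (3 * C + L + Wα + Wβ)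
                                 ≡ 3 * (C + L) + suc L + (α * 1 + (Wα + 1 * Sα)) + (β * 2 + (Wβ + 2 * Sβ))
  arith = solve-∀

sumE-fromBlocks : ∀ l → sumE (fromBlocks l) ≡ evenWeight l
sumE-fromBlocks []              = refl
sumE-fromBlocks ((α , β) ∷ l) = begin
    sumE (placeBlock (α , β) (fromBlocks l))
  ≡⟨ sumE-placeBlock α β (fromBlocks l) ⟩
    offset (fromBlocks l) + 2 * β + sumE (fromBlocks l)
  ≡⟨ cong₂ (λ o w → o + 2 * β + w) (offset-fromBlocks l) (sumE-fromBlocks l) ⟩
    3 * L + Sα + 2 * Sβ + 2 * β + (3 * C + Wα + Wβ)
  ≡⟨ arith α β L Sα Sβ C Wα Wβ ⟩
    3 * (C + L) + (α * 0 + (Wα + 1 * Sα)) + (β * 2 + (Wβ + 2 * Sβ))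
  ≡⟨ cong₂ (λ wα wβ → 3 * (C + L) + (α * 0 + wα) + (β * 2 + wβ))
       (sym (weightedSum-shift 1 (λ i → +-comm 1 i) as))
       (sym (weightedSum-shift 2 (λ i → trans (*-suc 2 (suc i)) (+-comm 2 _)) bs)) ⟩
    evenWeight ((α , β) ∷ l) ∎
  where
  open ≡-Reasoning
  L  = length l
  as = proj₁ (unzip l)
  bs = proj₂ (unzip l)
  Sα = sum as
  Sβ = sum bs
  C  = choose₂ L
  Wα = weightedSum id as
  Wβ = weightedSum (λ i → 2 * suc i) bs
  arith : ∀ α β L Sα Sβ C Wα Wβ → 3 * L + Sα + 2 * Sβ + 2 * β + (3 * C + Wα + Wβ)
                                 ≡ 3 * (C + L) + (α * 0 + (Wα + 1 * Sα)) + (β * 2 + (Wβ + 2 * Sβ))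
  arith = solve-∀

length≤oddWeight : ∀ l → length l ≤ oddWeight l
length≤oddWeight l =
  ≤-trans (m≤n+m (length l) (3 * choose₂ (length l))) (≤-trans (m≤m+n _ _) (m≤m+n _ _))

3*n*n≡2*[3*choose₂]+3*n : ∀ n → 3 * n * n ≡ 2 * (3 * choose₂ n) + 3 * n
3*n*n≡2*[3*choose₂]+3*n zero    = refl
3*n*n≡2*[3*choose₂]+3*n (suc n) = begin
    3 * suc n * suc n
  ≡⟨ expand n ⟩
    3 * n * n + 6 * n + 3
  ≡⟨ cong (λ t → t + 6 * n + 3) (3*n*n≡2*[3*choose₂]+3*n n) ⟩
    2 * (3 * choose₂ n) + 3 * n + 6 * n + 3
  ≡⟨ collect (choose₂ n) n ⟩
    2 * (3 * (choose₂ n + n)) + 3 * suc n ∎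
  where
  open ≡-Reasoning
  expand : ∀ n → 3 * suc n * suc n ≡ 3 * n * n + 6 * n + 3
  expand = solve-∀
  collect : ∀ c n → 2 * (3 * c) + 3 * n + 6 * n + 3 ≡ 2 * (3 * (c + n)) + 3 * suc n
  collect = solve-∀

m≡2k+n⇒[m∸n]/2≡k : ∀ {m n k} → m ≡ 2 * k + n → (m ∸ n) / 2 ≡ k
m≡2k+n⇒[m∸n]/2≡k {n = n} {k} refl = trans (cong (_/ 2) (m+n∸n≡m (2 * k) n)) (2*n/2≡n k)

pentagonal : ∀ n → (3 * n * n ∸ n) / 2 ≡ 3 * choose₂ n + n
pentagonal n = m≡2k+n⇒[m∸n]/2≡k (trans (3*n*n≡2*[3*choose₂]+3*n n) (regroup (choose₂ n) n))
  where
  regroup : ∀ c n → 2 * (3 * c) + 3 * n ≡ 2 * (3 * c + n) + n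
  regroup = solve-∀

pentagonal-3n : ∀ n → (3 * n * n ∸ 3 * n) / 2 ≡ 3 * choose₂ n
pentagonal-3n n = m≡2k+n⇒[m∸n]/2≡k (3*n*n≡2*[3*choose₂]+3*n n)

blocksOfLength : ∀ n → Enumeration (λ l → length l ≡ n) oddWeight evenWeight (term n)
blocksOfLength n = map-enumeration zipped (λ {x} {y} → injective {x} {y}) (λ {x} → preserves x) onto
  (monomial {wx = λ _ → (3 * n * n ∸ n) / 2} {wy = λ _ → (3 * n * n ∸ 3 * n) / 2} tt
    ⊗ geometricProduct suc id (λ _ → 0<1+n) n
    ⊗ geometricProduct (λ i → 2 * suc i) (λ i → 2 * suc i) (λ _ → 0<1+n) n)
  where
  Parts = (⊤ × List ℕ) × List ℕ
  Wβ : List ℕ → ℕ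
  Wβ = weightedSum (λ i → 2 * suc i)
  zipped : Parts → List (ℕ × ℕ)
  zipped ((_ , as) , bs) = zip as bs
  Lengths : Parts → Set
  Lengths ((u , as) , bs) = (u ≡ tt × length as ≡ n) × length bs ≡ n
  unzip-zipped : ∀ {x} → Lengths x → unzip (zipped x) ≡ (proj₂ (proj₁ x) , proj₂ x)
  unzip-zipped {(_ , as) , bs} ((_ , las) , lbs) = unzip-zip as bs (trans las (sym lbs))
  length-zipped : ∀ {x} → Lengths x → length (zipped x) ≡ n
  length-zipped {(_ , as) , bs} ((_ , las) , lbs) =
    trans (length-zipWith _,_ as bs) (trans (cong₂ _⊓_ las lbs) (⊓-idem n))
  injective : ∀ {x y} → Lengths x → Lengths y → zipped x ≡ zipped y → x ≡ y
  injective {x} {y} Lx Ly eq = cong (λ (as , bs) → (tt , as) , bs)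
    (trans (sym (unzip-zipped {x} Lx)) (trans (cong unzip eq) (unzip-zipped {y} Ly)))
  preserves : ∀ x → Lengths x →
    length (zipped x) ≡ n
    × oddWeight (zipped x) ≡ (3 * n * n ∸ n) / 2 + weightedSum suc (proj₂ (proj₁ x)) + Wβ (proj₂ x)
    × evenWeight (zipped x) ≡ (3 * n * n ∸ 3 * n) / 2 + weightedSum id (proj₂ (proj₁ x)) + Wβ (proj₂ x)
  preserves x@((_ , as) , bs) Lx =
    length-zipped {x} Lx ,
    trans (cong₂ (λ L (as , bs) → 3 * choose₂ L + L + weightedSum suc as + Wβ bs)
                 (length-zipped {x} Lx) (unzip-zipped {x} Lx))
          (cong (λ t → t + weightedSum suc as + Wβ bs) (sym (pentagonal n))) ,
    trans (cong₂ (λ L (as , bs) → 3 * choose₂ L + weightedSum id as + Wβ bs)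
                 (length-zipped {x} Lx) (unzip-zipped {x} Lx))
          (cong (λ t → t + weightedSum id as + Wβ bs) (sym (pentagonal-3n n)))
  onto : ∀ {l} → length l ≡ n → ∃[ x ] Lengths x × zipped x ≡ l
  onto {l} len = ((tt , proj₁ (unzip l)) , proj₂ (unzip l)) ,
    ((refl , trans (length-unzipWith₁ id l) len) , trans (length-unzipWith₂ id l) len) , zip-unzip l

blocks : Enumeration (λ l → ∃[ n ] length l ≡ n) oddWeight evenWeight rhsCoeff
blocks = sum-enumeration blocksOfLength (λ m≡ n≡ → trans (sym m≡) n≡) λ { {x = l} refl → length≤oddWeight l }

partitionsInG : Enumeration InG sumO sumE rhsCoeff
partitionsInG = map-enumeration fromBlocks (λ _ _ → fromBlocks-injective)
  (λ {l} _ → fromBlocks-InG l , sumO-fromBlocks l , sumE-fromBlocks l)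
  (λ {p} p∈G → toBlocks p , (_ , refl) , fromBlocks-toBlocks p p∈G)
  blocks

theorem5p4 : (a b : ℕ) →
    Σ (List (List ℕ)) (λ L →
    Unique L
    × ((p : List ℕ) → (p ∈ L) ⇔ (InG p × sumO p ≡ a × sumE p ≡ b))
    × length L ≡ rhsCoeff a b)
theorem5p4 a b =
  enum G a b , unique G a b , (λ p → mk⇔ (sound G) λ { (p∈G , refl , refl) → complete G p∈G }) , length-enum G a b
  where G = partitionsInG
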